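{- Let $N>2$ and $1\le i\le N-1$. For $k\ge 1$ let $A_k$ denote the game whose only options are a single Left option to $k_{C_i}$. Then $0<_L A_k$ for all $k\ge1$, $A_m<_L A_k$ for all $1\le k<m$, and $A_1<_L 1_L$; that is, $$0<_L\cdots<_L A_3<_L A_2<_L A_1<_L 1_L.$$
   Context: An $N$-player partizan game is an ordered $N$-tuple $(\mathscr G^{C_0},\dots,\mathscr G^{C_{N-1}})$ of finite sets of partizan games (no infinite runs); players Left $=C_0$, $C_1,\dots,C_{N-2}$, Right $=C_{N-1}$ move cyclically (Left after Right), $\mathscr G^{C_i}$ being the options for $C_i$. Under normal play, a player with no option on their turn is the unique loser and all others win. $0$ is the game with no options. $1_L$ is the game with one Left option to $0$ and no other options; $1_{C_i}$ is the game with one $C_i$-option to $0$ and no other options; $0_{C_i}=0$ and $k_{C_i}$ is the game whose $C_i$-options are $0,1_{C_i},\dots,(k-1)_{C_i}$ and which has no other options. The disjunctive sum $G+H$ has $C_j$-options $G^{C_j}+H$ and $G+H^{C_j}$. "Left has a winning strategy in $G$ moving $j$th" means that when play starts with the player for whom Left is $j$th to move, Left can guarantee not being the loser. $G\le_L H$ means: for every game $X$ and every $1\le j\le N$, if Left has a winning strategy in $G+X$ moving $j$th then Left has one in $H+X$ moving $j$th. $G<_L H$ means $G\le_L H$ and not $H\le_L G$. -}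

module Defs where

open import Data.Nat using (ℕ; zero; suc; _≟_)
open import Data.Fin using (Fin; zero; suc; toℕ; lower₁; opposite)
import Data.Fin as F
open import Data.List using (List; []; _∷_; _++_)
open import Data.List.Membership.Propositional using (_∈_)
open import Data.Product using (_×_; Σ; _,_)
open import Relation.Nullary using (¬_; yes; no)
open import Relation.Nullary.Decidable using (⌊_⌋)
open import Data.Bool using (if_then_else_)
open import Relation.Binary.PropositionalEquality using (_≢_)

-- Players are Fin (suc n), so N = suc n players.
-- Player zero is Left (C_0), player n is Right (C_{N-1}).

data Game (n : ℕ) : Set where
  mk : (Fin (suc n) → List (Game n)) → Game n

options : ∀ {n} → Game n → Fin (suc n) → List (Game n)
options (mk f) = f

next : ∀ {n} → Fin (suc n) → Fin (suc n)
next {n} p with n ≟ toℕ p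
... | yes _  = zero
... | no neq = suc (lower₁ p neq)

mutual
  _⊕_ : ∀ {n} → Game n → Game n → Game n
  mk f ⊕ mk g = mk (λ j → sumL (f j) (mk g) ++ sumR (mk f) (g j))

  sumL : ∀ {n} → List (Game n) → Game n → List (Game n)
  sumL []       h = []
  sumL (x ∷ xs) h = (x ⊕ h) ∷ sumL xs h

  sumR : ∀ {n} → Game n → List (Game n) → List (Game n)
  sumR g []       = []
  sumR g (y ∷ ys) = (g ⊕ y) ∷ sumR g ys

-- LWins G p : Left has a winning strategy (can guarantee not being the
-- unique loser) in G when it is player p's turn.
data LWins {n : ℕ} : Game n → Fin (suc n) → Set where
  leftMove  : ∀ {f G'} → G' ∈ f zero → LWins G' (next zero) → LWins (mk f) zero
  otherMove : ∀ {f p} → p ≢ zero →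
              (∀ {G'} → G' ∈ f p → LWins G' (next p)) → LWins (mk f) p

-- The player who starts when Left is to move j-th, where j : Fin N encodes
-- the ordinal (toℕ j + 1) ∈ {1,…,N}: the starter is C_{(N - toℕ j) mod N}.
starter : ∀ {n} → Fin (suc n) → Fin (suc n)
starter zero    = zero
starter (suc k) = suc (opposite k)

LeftWinsMoving : ∀ {n} → Game n → Fin (suc n) → Set
LeftWinsMoving G j = LWins G (starter j)

_≤L_ : ∀ {n} → Game n → Game n → Set
G ≤L H = ∀ X j → LeftWinsMoving (G ⊕ X) j → LeftWinsMoving (H ⊕ X) j

_<L_ : ∀ {n} → Game n → Game n → Set
G <L H = G ≤L H × ¬ (H ≤L G)

zeroG : ∀ {n} → Game n
zeroG = mk (λ _ → [])

onlyFor : ∀ {n} → Fin (suc n) → List (Game n) → Game n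
onlyFor i xs = mk (λ j → if ⌊ i F.≟ j ⌋ then xs else [])

mutual
  kC : ∀ {n} → Fin (suc n) → ℕ → Game n
  kC i k = onlyFor i (kList i k)

  kList : ∀ {n} → Fin (suc n) → ℕ → List (Game n)
  kList i zero    = []
  kList i (suc k) = kList i k ++ (kC i k ∷ [])

oneL : ∀ {n} → Game n
oneL = onlyFor zero (zeroG ∷ [])

A : ∀ {n} → Fin (suc n) → ℕ → Game n
A i k = onlyFor zero (kC i k ∷ [])

module Submission where

-- Write C_i for the fixed non-Left player, A_k for the game in
-- which Left's single move goes to the countdown k_{C_i}.
--   * The inequalities  0 ≤L A_k,  A_m ≤L A_k (k ≤ m),  A_1 ≤L 1_L  hold because
--     Left can play in H ⊕ X exactly as in G ⊕ X: a Left-simulation of G by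
--     H (Left's moves in G are matched in H, other players' moves in H exist
--     in G) yields G ≤L H for every G, H (module Simulation).  Facing a countdown of
--     height c, C_i runs out of moves iff c < k + 1 (`exhaust`, `outlast`),
--     so Left moving first wins A_k + T_k and 1_L + T_0 but loses 0 + T_k
--     (Left has no move, as N > 2) and A_m + T_k for m > k.

open import Defs
open import Data.Nat using (ℕ; suc; _<_; _≤_)
open import Data.Fin using (Fin; zero)
open import Data.Product using (_×_)
open import Relation.Binary.PropositionalEquality using (_≢_)

open import Data.Nat as ℕ using (_+_; _*_; z≤n; s≤s)
import Data.Nat.Properties as ℕP
open import Data.Fin as F using (toℕ)
import Data.Fin.Properties as FP
open import Data.List using (List; []; _∷_; _++_; map)
open import Data.List.Membership.Propositional using (_∈_)
open import Data.List.Membership.Propositional.Properties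
  using (∈-map⁺; ∈-map⁻; ∈-++⁻; ∈-++⁺ˡ; ∈-++⁺ʳ)
open import Data.List.Relation.Unary.Any using (here)
open import Data.Product using (∃; _,_)
open import Data.Sum using (inj₁; inj₂)
open import Data.Empty using (⊥-elim)
open import Relation.Nullary using (¬_; yes; no)
open import Relation.Binary.PropositionalEquality
  using (_≡_; refl; sym; trans; cong; cong₂; subst; module ≡-Reasoning)

module GameBasics {n : ℕ} where

  Player : Set
  Player = Fin (suc n)

  sumL≡map : ∀ xs (H : Game n) → sumL xs H ≡ map (_⊕ H) xs
  sumL≡map []       H = refl
  sumL≡map (x ∷ xs) H = cong (x ⊕ H ∷_) (sumL≡map xs H)

  sumR≡map : ∀ (G : Game n) ys → sumR G ys ≡ map (G ⊕_) ys
  sumR≡map G []       = refl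
  sumR≡map G (y ∷ ys) = cong (G ⊕ y ∷_) (sumR≡map G ys)

  data SumOption (G H : Game n) (p : Player) : Game n → Set where
    inFirst  : ∀ {G'} → G' ∈ options G p → SumOption G H p (G' ⊕ H)
    inSecond : ∀ {H'} → H' ∈ options H p → SumOption G H p (G ⊕ H')

  sumOption : ∀ G H p {Y} → Y ∈ options (G ⊕ H) p → SumOption G H p Y
  sumOption (mk f) (mk g) p mem with ∈-++⁻ (sumL (f p) (mk g)) mem
  ... | inj₁ memL with ∈-map⁻ (_⊕ mk g) (subst (_ ∈_) (sumL≡map (f p) (mk g)) memL)
  ...   | _ , mem' , refl = inFirst mem'
  sumOption (mk f) (mk g) p mem | inj₂ memR
    with ∈-map⁻ (mk f ⊕_) (subst (_ ∈_) (sumR≡map (mk f) (g p)) memR)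
  ...   | _ , mem' , refl = inSecond mem'

  moveInFirst : ∀ G H p {G'} → G' ∈ options G p → (G' ⊕ H) ∈ options (G ⊕ H) p
  moveInFirst (mk f) (mk g) p mem =
    ∈-++⁺ˡ (subst (_ ∈_) (sym (sumL≡map (f p) (mk g))) (∈-map⁺ (_⊕ mk g) mem))

  moveInSecond : ∀ G H p {H'} → H' ∈ options H p → (G ⊕ H') ∈ options (G ⊕ H) p
  moveInSecond (mk f) (mk g) p mem =
    ∈-++⁺ʳ (sumL (f p) (mk g))
      (subst (_ ∈_) (sym (sumR≡map (mk f) (g p))) (∈-map⁺ (mk f ⊕_) mem))

  leftWinsByMove : ∀ {G G' : Game n} → G' ∈ options G zero → LWins G' (next zero) → LWins G zero
  leftWinsByMove {mk f} = leftMove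

  leftWinsAgainstAll : ∀ {G : Game n} {p} → p ≢ zero →
    (∀ {G'} → G' ∈ options G p → LWins G' (next p)) → LWins G p
  leftWinsAgainstAll {mk f} = otherMove

  leftWinningMove : ∀ {G : Game n} → LWins G zero →
    ∃ λ G' → G' ∈ options G zero × LWins G' (next zero)
  leftWinningMove (leftMove mem w)   = _ , mem , w
  leftWinningMove (otherMove p≢0 _) = ⊥-elim (p≢0 refl)

  leftSurvives : ∀ {G : Game n} {p} → p ≢ zero → LWins G p →
    ∀ {G'} → G' ∈ options G p → LWins G' (next p)
  leftSurvives p≢0 (leftMove _ _)     = ⊥-elim (p≢0 refl)
  leftSurvives _   (otherMove _ wins) = wins

  onlyFor-same : ∀ i (xs : List (Game n)) → options (onlyFor i xs) i ≡ xs
  onlyFor-same i xs with i F.≟ i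
  ... | yes _   = refl
  ... | no i≢i = ⊥-elim (i≢i refl)

  onlyFor-other : ∀ {i j Y} (xs : List (Game n)) → i ≢ j → ¬ Y ∈ options (onlyFor i xs) j
  onlyFor-other {i} {j} xs i≢j mem with i F.≟ j
  onlyFor-other {i} {j} xs i≢j ()  | no _
  ... | yes i≡j = i≢j i≡j

  single-option : ∀ q {Y S : Game n} → Y ∈ options (onlyFor q (S ∷ [])) q → Y ≡ S
  single-option q {Y} {S} mem with subst (Y ∈_) (onlyFor-same q (S ∷ [])) mem
  ... | here Y≡S = Y≡S

  the-option : ∀ q (S : Game n) → S ∈ options (onlyFor q (S ∷ [])) q
  the-option q S = subst (S ∈_) (sym (onlyFor-same q (S ∷ []))) (here refl)

-- Left then copies her strategy from G ⊕ X to H ⊕ X.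
module Simulation {n : ℕ} (R : Game n → Game n → Set)
  (match-left : ∀ {G H G'} → R G H → G' ∈ options G zero →
                ∃ λ H' → H' ∈ options H zero × R G' H')
  (others-available : ∀ {G H H' p} → R G H → p ≢ zero →
                      H' ∈ options H p → H' ∈ options G p)
  where
  open GameBasics

  simulate : ∀ {G H} → R G H → ∀ X p → LWins (G ⊕ X) p → LWins (H ⊕ X) p
  simulate {mk g} {mk h} r (mk x) .zero (leftMove mem w) =
    leftWins (sumOption (mk g) (mk x) zero mem) w
    where
    leftWins : ∀ {Y} → SumOption (mk g) (mk x) zero Y → LWins Y (next zero) →
               LWins (mk h ⊕ mk x) zero
    leftWins (inFirst memG) w' with match-left r memG
    ... | H' , memH , r' =
      leftMove (moveInFirst (mk h) (mk x) zero memH) (simulate r' (mk x) (next zero) w')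
    leftWins (inSecond memX) w' =
      leftMove (moveInSecond (mk h) (mk x) zero memX) (simulate r _ (next zero) w')
  simulate {mk g} {mk h} r (mk x) p (otherMove p≢0 wins) =
    otherMove p≢0 λ mem → answer (sumOption (mk h) (mk x) p mem)
    where
    answer : ∀ {Y} → SumOption (mk h) (mk x) p Y → LWins Y (next p)
    answer (inFirst memH)  = wins (moveInFirst (mk g) (mk x) p (others-available r p≢0 memH))
    answer (inSecond memX) = simulate r _ (next p) (wins (moveInSecond (mk g) (mk x) p memX))

  simulation⇒≤L : ∀ {G H} → R G H → G ≤L H
  simulation⇒≤L r X j = simulate r X (starter j)

strict-by-test : ∀ {n} {G H : Game n} X →
  G ≤L H → LWins (H ⊕ X) zero → ¬ LWins (G ⊕ X) zero → G <L H
strict-by-test X G≤H winH loseG = G≤H , λ H≤G → loseG (H≤G X zero winH)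

module Countdowns {n : ℕ} (i : Fin (suc n)) (i≢0 : i ≢ zero) where
  open GameBasics {n}

  0≢i : zero ≢ i
  0≢i 0≡i = i≢0 (sym 0≡i)

  kList⁻ : ∀ {Y} k → Y ∈ kList i k → ∃ λ j → j < k × Y ≡ kC i j
  kList⁻ (suc k) mem with ∈-++⁻ (kList i k) mem
  ... | inj₁ mem' with kList⁻ k mem'
  ...   | j , j<k , refl = j , ℕP.m<n⇒m<1+n j<k , refl
  kList⁻ (suc k) mem | inj₂ (here refl) = k , ℕP.n<1+n k , refl

  kList⁺ : ∀ {j} k → j < k → kC i j ∈ kList i k
  kList⁺ (suc k) j<1+k with ℕP.m≤n⇒m<n∨m≡n (ℕP.≤-pred j<1+k)
  ... | inj₁ j<k  = ∈-++⁺ˡ (kList⁺ k j<k)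
  ... | inj₂ refl = ∈-++⁺ʳ (kList i k) (here refl)

  kList-mono : ∀ {Y k m} → k ≤ m → Y ∈ kList i k → Y ∈ kList i m
  kList-mono {k = k} {m} k≤m mem with kList⁻ k mem
  ... | j , j<k , refl = kList⁺ m (ℕP.<-≤-trans j<k k≤m)

  -- The order relations of the theorem are all witnessed by one Left-simulation.
  data Dominated : Game n → Game n → Set where
    0≼A   : ∀ {k} → Dominated zeroG (A i k)
    A≼A   : ∀ {k m} → k ≤ m → Dominated (A i m) (A i k)
    kC≼kC : ∀ {k m} → k ≤ m → Dominated (kC i m) (kC i k)
    kC≼0  : ∀ {k} → Dominated (kC i k) zeroG
    A₁≼1L : Dominated (A i 1) oneL

  dominated-left : ∀ {G H G'} → Dominated G H → G' ∈ options G zero →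
                   ∃ λ H' → H' ∈ options H zero × Dominated G' H'
  dominated-left 0≼A ()
  dominated-left (A≼A {k} k≤m) mem with single-option zero mem
  ... | refl = kC i k , the-option zero (kC i k) , kC≼kC k≤m
  dominated-left (kC≼kC {m = m} _) mem = ⊥-elim (onlyFor-other (kList i m) i≢0 mem)
  dominated-left (kC≼0 {k}) mem = ⊥-elim (onlyFor-other (kList i k) i≢0 mem)
  dominated-left A₁≼1L mem with single-option zero mem
  ... | refl = zeroG , the-option zero zeroG , kC≼0 {1}

  dominated-others : ∀ {G H H' p} → Dominated G H → p ≢ zero →
                     H' ∈ options H p → H' ∈ options G p
  dominated-others (0≼A {k}) p≢0 mem =
    ⊥-elim (onlyFor-other (kC i k ∷ []) (λ 0≡p → p≢0 (sym 0≡p)) mem)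
  dominated-others (A≼A {k} _) p≢0 mem =
    ⊥-elim (onlyFor-other (kC i k ∷ []) (λ 0≡p → p≢0 (sym 0≡p)) mem)
  dominated-others {p = p} (kC≼kC k≤m) _ mem with i F.≟ p
  ... | yes refl = kList-mono k≤m mem
  dominated-others (kC≼kC k≤m) _ () | no _
  dominated-others kC≼0 _ ()
  dominated-others A₁≼1L p≢0 mem =
    ⊥-elim (onlyFor-other (zeroG ∷ []) (λ 0≡p → p≢0 (sym 0≡p)) mem)

  open Simulation Dominated dominated-left dominated-others public
    using (simulation⇒≤L)

  -- A countdown of height c: only C_i can move, always to a countdown of
  -- smaller height, and (if c > 0) to one of height c − 1.  Besides k_{C_i}
  -- this includes 0, the position reached from 1_L.
  data Countdown : ℕ → Game n → Set where
    kC-countdown   : ∀ {c} → Countdown c (kC i c)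
    zero-countdown : Countdown 0 zeroG

  countdown-others : ∀ {c H q Y} → Countdown c H → q ≢ i → ¬ Y ∈ options H q
  countdown-others (kC-countdown {c}) q≢i = onlyFor-other (kList i c) (λ i≡q → q≢i (sym i≡q))
  countdown-others zero-countdown _ ()

  countdown-down : ∀ {c H Y} → Countdown c H → Y ∈ options H i →
                   ∃ λ c' → c' < c × Countdown c' Y
  countdown-down {Y = Y} (kC-countdown {c}) mem
    with kList⁻ c (subst (Y ∈_) (onlyFor-same i (kList i c)) mem)
  ... | c' , c'<c , refl = c' , c'<c , kC-countdown
  countdown-down zero-countdown ()

  countdown-step : ∀ {c H} → Countdown (suc c) H → kC i c ∈ options H i
  countdown-step (kC-countdown {suc c}) =
    subst (kC i c ∈_) (sym (onlyFor-same i (kList i (suc c)))) (kList⁺ (suc c) (ℕP.n<1+n c))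

  after : Player → ℕ → Player
  after p ℕ.zero  = p
  after p (suc t) = after (next p) t

  turnsOfI : Player → ℕ → ℕ
  turnsOfI p ℕ.zero = 0
  turnsOfI p (suc t) with p F.≟ i
  ... | yes _ = suc (turnsOfI (next p) t)
  ... | no _  = turnsOfI (next p) t

  schedule : Player → ℕ → List Player
  schedule p ℕ.zero = []
  schedule p (suc t) with p F.≟ i
  ... | yes _ = schedule (next p) t
  ... | no _  = p ∷ schedule (next p) t

  forced : List Player → Game n
  forced []       = zeroG
  forced (q ∷ qs) = onlyFor q (forced qs ∷ [])

  schedule-skips-i : ∀ p t {Y} → ¬ Y ∈ options (forced (schedule p t)) i
  schedule-skips-i p ℕ.zero ()
  schedule-skips-i p (suc t) mem with p F.≟ i
  ... | yes _ = schedule-skips-i (next p) t mem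
  ... | no p≢i = onlyFor-other (forced (schedule (next p) t) ∷ []) p≢i mem

  -- In a countdown of height c played against the schedule of t turns from
  -- p, everybody but C_i has exactly one move on each of their turns, while
  -- C_i must move in the countdown.  If C_i has more than c turns, C_i runs
  -- out of moves first, so Left wins.
  exhaust : ∀ t p c {H} → Countdown c H → c < turnsOfI p t →
            LWins (H ⊕ forced (schedule p t)) p
  exhaust (suc t) p c {H} cd c<turns with p F.≟ i
  ... | yes refl = leftWinsAgainstAll i≢0 λ mem → answer (sumOption H _ p mem)
    where
    answer : ∀ {Y} → SumOption H (forced (schedule (next p) t)) p Y → LWins Y (next p)
    answer (inFirst mem) with countdown-down cd mem
    ... | c' , c'<c , cd' = exhaust t (next p) c' cd' (ℕP.<-≤-trans c'<c (ℕP.≤-pred c<turns))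
    answer (inSecond mem) = ⊥-elim (schedule-skips-i (next p) t mem)
  exhaust (suc t) zero c {H} cd c<turns | no _ =
    leftWinsByMove (moveInSecond H _ zero (the-option zero _)) (exhaust t (next zero) c cd c<turns)
  exhaust (suc t) (F.suc q) c {H} cd c<turns | no q≢i =
    leftWinsAgainstAll (λ ()) λ mem → answer (sumOption H _ (F.suc q) mem)
    where
    answer : ∀ {Y} → SumOption H (forced (F.suc q ∷ schedule (next (F.suc q)) t)) (F.suc q) Y →
             LWins Y (next (F.suc q))
    answer (inFirst mem) = ⊥-elim (countdown-others cd q≢i mem)
    answer (inSecond mem) with single-option (F.suc q) mem
    ... | refl = exhaust t (next (F.suc q)) c cd c<turns

  -- Conversely, if C_i has at most c turns and Left is to move when the
  -- schedule is over, C_i can always count down by one, and Left loses.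
  outlast : ∀ t p c {H} → Countdown c H → turnsOfI p t ≤ c → after p t ≡ zero →
            ¬ LWins (H ⊕ forced (schedule p t)) p
  outlast ℕ.zero p c {H} cd _ refl w with leftWinningMove w
  ... | _ , mem , _ with sumOption H zeroG zero mem
  ...   | inFirst memH = countdown-others cd 0≢i memH
  outlast (suc t) p c {H} cd turns≤c end w with p F.≟ i
  outlast (suc t) p (suc c) {H} cd (s≤s turns≤c) end w | yes refl =
    outlast t (next p) c kC-countdown turns≤c end
      (leftSurvives i≢0 w (moveInFirst H _ p (countdown-step cd)))
  outlast (suc t) zero c {H} cd turns≤c end w | no _ with leftWinningMove w
  ... | _ , mem , w' with sumOption H _ zero mem
  ...   | inFirst memH = countdown-others cd 0≢i memH
  ...   | inSecond memX with single-option zero memX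
  ...     | refl = outlast t (next zero) c cd turns≤c end w'
  outlast (suc t) (F.suc q) c {H} cd turns≤c end w | no _ =
    outlast t (next (F.suc q)) c cd turns≤c end
      (leftSurvives (λ ()) w (moveInSecond H _ (F.suc q) (the-option (F.suc q) _)))

  after-+ : ∀ p a b → after p (a + b) ≡ after (after p a) b
  after-+ p ℕ.zero  b = refl
  after-+ p (suc a) b = after-+ (next p) a b

  after-suc : ∀ p t → after p (suc t) ≡ next (after p t)
  after-suc p t = trans (cong (after p) (ℕP.+-comm 1 t)) (after-+ p t 1)

  turnsOfI-+ : ∀ p a b → turnsOfI p (a + b) ≡ turnsOfI p a + turnsOfI (after p a) b
  turnsOfI-+ p ℕ.zero  b = refl
  turnsOfI-+ p (suc a) b with p F.≟ i
  ... | yes _ = cong suc (turnsOfI-+ (next p) a b)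
  ... | no _  = turnsOfI-+ (next p) a b

  turnsOfI-suc : ∀ p t → turnsOfI p (suc t) ≡ turnsOfI p t + turnsOfI (after p t) 1
  turnsOfI-suc p t = trans (cong (turnsOfI p) (ℕP.+-comm 1 t)) (turnsOfI-+ p t 1)

  turnsOfI-1-i : turnsOfI i 1 ≡ 1
  turnsOfI-1-i with i F.≟ i
  ... | yes _   = refl
  ... | no i≢i = ⊥-elim (i≢i refl)

  turnsOfI-1-other : ∀ q → q ≢ i → turnsOfI q 1 ≡ 0
  turnsOfI-1-other q q≢i with q F.≟ i
  ... | yes q≡i = ⊥-elim (q≢i q≡i)
  ... | no _    = refl

  toℕ-next : ∀ (q : Player) → toℕ q ≢ n → toℕ (next q) ≡ suc (toℕ q)
  toℕ-next q q≢n with n ℕ.≟ toℕ q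
  ... | yes n≡q = ⊥-elim (q≢n (sym n≡q))
  ... | no n≢q  = cong suc (FP.toℕ-lower₁ q n≢q)

  next-last : ∀ (q : Player) → toℕ q ≡ n → next q ≡ zero
  next-last q q≡n with n ℕ.≟ toℕ q
  ... | yes _   = refl
  ... | no n≢q = ⊥-elim (n≢q (sym q≡n))

  toℕ-after-zero : ∀ j → j ≤ n → toℕ (after zero j) ≡ j
  toℕ-after-zero ℕ.zero  _   = refl
  toℕ-after-zero (suc j) j<n = begin
    toℕ (after zero (suc j))  ≡⟨ cong toℕ (after-suc zero j) ⟩
    toℕ (next (after zero j)) ≡⟨ toℕ-next _ (λ j≡n → ℕP.<⇒≢ j<n (trans (sym IH) j≡n)) ⟩
    suc (toℕ (after zero j))  ≡⟨ cong suc IH ⟩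
    suc j                     ∎
    where
    open ≡-Reasoning
    IH : toℕ (after zero j) ≡ j
    IH = toℕ-after-zero j (ℕP.<⇒≤ j<n)

  after-round : after zero (suc n) ≡ zero
  after-round = trans (after-suc zero n) (next-last _ (toℕ-after-zero n ℕP.≤-refl))

  turn-of-i : ∀ j → j ≤ n → after zero j ≡ i → j ≡ toℕ i
  turn-of-i j j≤n hit = trans (sym (toℕ-after-zero j j≤n)) (cong toℕ hit)

  toℕi≤n : toℕ i ≤ n
  toℕi≤n = FP.toℕ≤pred[n] i

  turns-before-i : ∀ j → j ≤ toℕ i → turnsOfI zero j ≡ 0
  turns-before-i ℕ.zero  _   = refl
  turns-before-i (suc j) j<i = begin
    turnsOfI zero (suc j)                        ≡⟨ turnsOfI-suc zero j ⟩
    turnsOfI zero j + turnsOfI (after zero j) 1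
      ≡⟨ cong (_+ turnsOfI (after zero j) 1) (turns-before-i j (ℕP.<⇒≤ j<i)) ⟩
    turnsOfI (after zero j) 1                    ≡⟨ turnsOfI-1-other _ not-i ⟩
    0                                            ∎
    where
    open ≡-Reasoning
    not-i : after zero j ≢ i
    not-i hit = ℕP.<⇒≢ j<i (turn-of-i j (ℕP.≤-trans (ℕP.<⇒≤ j<i) toℕi≤n) hit)

  turns-after-i : ∀ j → toℕ i < j → j ≤ suc n → turnsOfI zero j ≡ 1
  turns-after-i (suc j) (s≤s i≤j) (s≤s j≤n) with ℕP.m≤n⇒m<n∨m≡n i≤j
  ... | inj₂ refl = begin
    turnsOfI zero (suc (toℕ i))                          ≡⟨ turnsOfI-suc zero (toℕ i) ⟩
    turnsOfI zero (toℕ i) + turnsOfI (after zero (toℕ i)) 1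
      ≡⟨ cong₂ _+_ (turns-before-i (toℕ i) ℕP.≤-refl) (cong (λ q → turnsOfI q 1) at-i) ⟩
    turnsOfI i 1                                         ≡⟨ turnsOfI-1-i ⟩
    1                                                    ∎
    where
    open ≡-Reasoning
    at-i : after zero (toℕ i) ≡ i
    at-i = FP.toℕ-injective (toℕ-after-zero (toℕ i) toℕi≤n)
  ... | inj₁ i<j = begin
    turnsOfI zero (suc j)                        ≡⟨ turnsOfI-suc zero j ⟩
    turnsOfI zero j + turnsOfI (after zero j) 1
      ≡⟨ cong₂ _+_ (turns-after-i j i<j (ℕP.m≤n⇒m≤1+n j≤n)) (turnsOfI-1-other _ not-i) ⟩
    1                                            ∎
    where
    open ≡-Reasoning
    not-i : after zero j ≢ i
    not-i hit = ℕP.<⇒≢ i<j (sym (turn-of-i j j≤n hit))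

  turns-round : turnsOfI zero (suc n) ≡ 1
  turns-round = turns-after-i (suc n) (s≤s toℕi≤n) ℕP.≤-refl

  after-rounds : ∀ r → after zero (r * suc n) ≡ zero
  after-rounds ℕ.zero  = refl
  after-rounds (suc r) = begin
    after zero (suc n + r * suc n)        ≡⟨ after-+ zero (suc n) (r * suc n) ⟩
    after (after zero (suc n)) (r * suc n) ≡⟨ cong (λ q → after q (r * suc n)) after-round ⟩
    after zero (r * suc n)                ≡⟨ after-rounds r ⟩
    zero                                  ∎
    where open ≡-Reasoning

  turns-rounds : ∀ r → turnsOfI zero (r * suc n) ≡ r
  turns-rounds ℕ.zero  = refl
  turns-rounds (suc r) = begin
    turnsOfI zero (suc n + r * suc n)
      ≡⟨ turnsOfI-+ zero (suc n) (r * suc n) ⟩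
    turnsOfI zero (suc n) + turnsOfI (after zero (suc n)) (r * suc n)
      ≡⟨ cong₂ _+_ turns-round (cong (λ q → turnsOfI q (r * suc n)) after-round) ⟩
    suc (turnsOfI zero (r * suc n))
      ≡⟨ cong suc (turns-rounds r) ⟩
    suc r ∎
    where open ≡-Reasoning

  turnsOfI-from-left : ∀ t → turnsOfI zero (suc t) ≡ turnsOfI (next zero) t
  turnsOfI-from-left t with zero F.≟ i
  ... | yes 0≡i = ⊥-elim (0≢i 0≡i)
  ... | no _    = refl

  schedule-starts-late : ∀ p t {Y} → p ≢ zero → p ≢ i →
                         ¬ Y ∈ options (forced (schedule p t)) zero
  schedule-starts-late p ℕ.zero _ _ ()
  schedule-starts-late p (suc t) p≢0 p≢i mem with p F.≟ i
  ... | yes p≡i = p≢i p≡i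
  ... | no _    = onlyFor-other (forced (schedule (next p) t) ∷ []) p≢0 mem

-- With N = m + 3 ≥ 3 players: the test game T_k, forced play along the
-- schedule that starts just after Left's opening move and lasts k + 1
-- rounds.  It separates A_k from 0 and from every A_l with l > k, and A_1
-- (with k = 0) from 1_L.
module TestGames {m : ℕ} (i : Fin (suc (suc (suc m)))) (i≢0 : i ≢ zero) where
  open GameBasics
  open Countdowns i i≢0

  -- the number of turns from C_1 up to Left's turn after k + 1 rounds
  duration : ℕ → ℕ
  duration k = suc (suc m) + k * suc (suc (suc m))

  test : ℕ → Game (suc (suc m))
  test k = forced (schedule (next zero) (duration k))

  test-ends-with-left : ∀ k → after (next zero) (duration k) ≡ zero
  test-ends-with-left k = after-rounds (suc k)

  test-turns-of-i : ∀ k → turnsOfI (next zero) (duration k) ≡ suc k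
  test-turns-of-i k = trans (sym (turnsOfI-from-left (duration k))) (turns-rounds (suc k))

  -- Left has no move in T_k itself: the first two turns of its schedule
  -- belong to C_1 and C_2, and at most one of them is C_i.
  test-no-left : ∀ k {Y} → ¬ Y ∈ options (test k) zero
  test-no-left k mem with F.suc zero F.≟ i
  test-no-left k () | no _
  ... | yes 1≡i =
    schedule-starts-late (F.suc (F.suc zero)) (suc m + k * suc (suc (suc m))) (λ ()) 2≢i mem
    where
    2≢i : F.suc (F.suc zero) ≢ i
    2≢i 2≡i with trans 1≡i (sym 2≡i)
    ... | ()

  -- Left wins A_k + T_k (and 1_L + T_0) moving first: C_i needs k + 1 moves.
  A-wins : ∀ k → LWins (A i k ⊕ test k) zero
  A-wins k = leftWinsByMove (moveInFirst (A i k) (test k) zero (the-option zero (kC i k)))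
    (exhaust (duration k) (next zero) k kC-countdown
      (subst (k <_) (sym (test-turns-of-i k)) (ℕP.n<1+n k)))

  oneL-wins : LWins (oneL ⊕ test 0) zero
  oneL-wins = leftWinsByMove (moveInFirst oneL (test 0) zero (the-option zero zeroG))
    (exhaust (duration 0) (next zero) 0 zero-countdown
      (subst (0 <_) (sym (test-turns-of-i 0)) (s≤s z≤n)))

  zero-loses : ∀ k → ¬ LWins (zeroG ⊕ test k) zero
  zero-loses k w with leftWinningMove w
  ... | _ , mem , _ with sumOption zeroG (test k) zero mem
  ...   | inSecond memT = test-no-left k memT

  A-loses : ∀ k l → k < l → ¬ LWins (A i l ⊕ test k) zero
  A-loses k l k<l w with leftWinningMove w
  ... | _ , mem , w' with sumOption (A i l) (test k) zero mem
  ...   | inSecond memT = test-no-left k memT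
  ...   | inFirst memA with single-option zero memA
  ...     | refl = outlast (duration k) (next zero) l kC-countdown
                     (subst (_≤ l) (sym (test-turns-of-i k)) k<l) (test-ends-with-left k) w'

mainTheorem18 : (n : ℕ) → 2 < suc n → (i : Fin (suc n)) → i ≢ zero →
    ((k : ℕ) → 1 ≤ k → zeroG <L A i k)
    × ((k m : ℕ) → 1 ≤ k → k < m → A i m <L A i k)
    × (A i 1 <L oneL)
mainTheorem18 ℕ.zero (s≤s ()) _ _
mainTheorem18 (suc ℕ.zero) (s≤s (s≤s ())) _ _
mainTheorem18 (suc (suc n)) _ i i≢0 = zero<A , A<A , A₁<1L
  where
  open Countdowns i i≢0 using (0≼A; A≼A; A₁≼1L; simulation⇒≤L)
  open TestGames i i≢0

  zero<A : (k : ℕ) → 1 ≤ k → zeroG <L A i k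
  zero<A k _ = strict-by-test (test k) (simulation⇒≤L (0≼A {k})) (A-wins k) (zero-loses k)

  A<A : (k m : ℕ) → 1 ≤ k → k < m → A i m <L A i k
  A<A k m _ k<m =
    strict-by-test (test k) (simulation⇒≤L (A≼A (ℕP.<⇒≤ k<m))) (A-wins k) (A-loses k m k<m)

  A₁<1L : A i 1 <L oneL
  A₁<1L = strict-by-test (test 0) (simulation⇒≤L A₁≼1L) oneL-wins (A-loses 0 1 ℕP.≤-refl)
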